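{- There is a randomized algorithm which, given the vertex set $V(G)$ of a graph $G$ (whose edges are unknown) that is promised to have a vertex cover of size at most $k$, the positive integer $k$, and access to a BISE oracle for $G$, makes $\mathcal{O}(k^2\log k)$ BISE queries and, with probability at least $1-1/k^{c}$ for some constant $c>0$, outputs a vertex cover of $G$ of size at most $k$.
   Context: The BISE oracle takes as input two disjoint non-empty subsets $A,B\subseteq V(G)$ and returns some edge $(u,v)\in E(G)$ with $u\in A$, $v\in B$ if one exists (an arbitrary such edge), and NULL otherwise. A vertex cover is a set of vertices containing at least one endpoint of every edge. Only oracle queries are counted. -}

module Defs where

open import Data.Nat using (ℕ; zero; suc; _⊔_; _≤_; NonZero)
open import Data.Bool using (Bool; true; false)
open import Data.Fin using (Fin)
open import Data.Fin.Subset using (Subset; _∈_; _∉_; ∣_∣; Nonempty)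
open import Data.Maybe using (Maybe; just; nothing)
open import Data.Product using (_×_; _,_; ∃; ∃-syntax)
open import Data.Empty using (⊥)
open import Data.Sum using (_⊎_)
open import Data.Integer using (+_)
open import Data.Rational using (ℚ; 0ℚ; 1ℚ; ½; _*_; _+_)
open import Relation.Binary.PropositionalEquality using (_≡_)

record Graph (n : ℕ) : Set where
  field
    adj     : Fin n → Fin n → Bool
    adj-sym : ∀ u v → adj u v ≡ adj v u
    adj-irr : ∀ u → adj u u ≡ false

open Graph public

Edge : ∀ {n} → Graph n → Fin n → Fin n → Set
Edge G u v = adj G u v ≡ true

IsVertexCover : ∀ {n} → Graph n → Subset n → Set
IsVertexCover G S = ∀ u v → Edge G u v → u ∈ S ⊎ v ∈ S

HasVertexCoverOfSize≤ : ∀ {n} → Graph n → ℕ → Set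
HasVertexCoverOfSize≤ G k = ∃[ S ] IsVertexCover G S × ∣ S ∣ ≤ k

Disjoint : ∀ {n} → Subset n → Subset n → Set
Disjoint A B = ∀ x → x ∈ A → x ∉ B

Answer : ℕ → Set
Answer n = Maybe (Fin n × Fin n)

Oracle : ℕ → Set
Oracle n = Subset n → Subset n → Answer n

-- On invalid
-- queries its answer is unconstrained.
IsBISE : ∀ {n} → Graph n → Oracle n → Set
IsBISE {n} G O =
  ∀ (A B : Subset n) → Disjoint A B → Nonempty A → Nonempty B →
    (∀ u v → O A B ≡ just (u , v) → u ∈ A × v ∈ B × Edge G u v)
  × (O A B ≡ nothing → ∀ u v → u ∈ A → v ∈ B → Edge G u v → ⊥)

-- Randomized query algorithms on vertex set Fin n: finite trees whose
-- internal nodes either flip a fair coin or make a BISE query (and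
-- branch on the answer), and whose leaves output a vertex subset.

data Alg (n : ℕ) : Set where
  ret   : Subset n → Alg n
  coin  : (Bool → Alg n) → Alg n
  query : Subset n → Subset n → (Answer n → Alg n) → Alg n

queries : ∀ {n} → Oracle n → Alg n → ℕ
queries O (ret S)         = 0
queries O (coin f)        = queries O (f true) ⊔ queries O (f false)
queries O (query A B k)   = suc (queries O (k (O A B)))

-- GoodMass P O t p : p is the total probability of some set of
-- executions of t (against O) all of whose outputs satisfy P.  Hence
-- Pr[output of t satisfies P] ≥ p, and the maximal such p is exactly
-- that probability.
data GoodMass {n : ℕ} (P : Subset n → Set) (O : Oracle n) : Alg n → ℚ → Set where
  ret-good : ∀ {S} → P S → GoodMass P O (ret S) 1ℚ
  ret-any  : ∀ {S} → GoodMass P O (ret S) 0ℚ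
  coin     : ∀ {f p q} → GoodMass P O (f true) p → GoodMass P O (f false) q →
             GoodMass P O (coin f) (½ * (p + q))
  query    : ∀ {A B k p} → GoodMass P O (k (O A B)) p →
             GoodMass P O (query A B k) p

_^ℚ_ : ℚ → ℕ → ℚ
x ^ℚ zero  = 1ℚ
x ^ℚ suc m = x * (x ^ℚ m)

toℚ : ℕ → ℚ
toℚ k = + k Data.Rational./ 1

module Submission where

-- The algorithm keeps a set X of processed vertices and, for each vertex z,
-- a set N z of learned neighbours.  A round draws 2k uniformly random subsets
-- A and asks for an edge between A ∖ X and (V ∖ A) ∖ X; for a found edge xy,
-- up to k+1 queries ({x}, V ∖ ({x} ∪ learned)) reveal all neighbours of x or
-- more than k of them (forcing x into every cover of size ≤ k), likewise for
-- y, and x, y join X.  After k rounds, or a round finding nothing, it outputs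
-- a set of size ≤ k covering the learned edges (exhaustive search, no queries).
--
-- Every found edge meets a fixed cover K outside X, so |K ∖ X| drops in each
-- successful round; once no edge avoids X, covers of the learned edges cover
-- G.  A round misses an existing edge with probability ≤ 2^-2k (no subset
-- separates its endpoints), so success has probability ≥ 1 - k·2^-2k ≥ 1 - 1/k,
-- with k(4k+2) ≤ 6k² queries.

open import Defs
open import Data.Nat using (ℕ; _≤_; _*_; _^_; _+_)
open import Data.Nat.Logarithm using (⌊log₂_⌋)
open import Data.Fin.Subset using (∣_∣)
open import Data.Product using (_×_; Σ; ∃-syntax)
open import Data.Rational using (ℚ; 1ℚ) renaming (_≤_ to _≤ℚ_; _*_ to _*ℚ_; _-_ to _-ℚ_)

open import Data.Nat using (zero; suc; _<_; s≤s; z≤n)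
import Data.Nat.Properties as ℕP
import Data.Nat.Solver as ℕS
open import Data.Integer using (+_; +≤+) renaming (_+_ to _+ℤ_; _*_ to _*ℤ_)
import Data.Integer.Solver as ℤS
open import Data.Rational using (0ℚ; ½; nonNegative; *≤*; toℚᵘ) renaming (_+_ to _+ℚ_)
import Data.Rational.Properties as ℚP
import Data.Rational.Solver as ℚS
open import Data.Rational.Unnormalised using (mkℚᵘ; *≡*) renaming (_+_ to _+ᵘ_)
import Data.Rational.Unnormalised.Properties as ℚᵘP
open import Data.Bool using (Bool; true; false) renaming (_≟_ to _≟ᵇ_)
open import Data.Fin using (Fin; zero; suc) renaming (_≟_ to _≟ᶠ_)
open import Data.Fin.Subset using (Subset; _∈_; _∉_; _⊆_; _∩_; _∪_; ∁; ⁅_⁆; ⊥; Nonempty)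
open import Data.Fin.Subset.Properties
  using ( _∈?_; nonempty?; anySubset?; x∈p∩q⁺; x∈p∩q⁻; x∈p∪q⁺; x∈p∪q⁻; x∈∁p⇒x∉p
        ; x∉p⇒x∈∁p; x∈⁅x⁆; x∈⁅y⁆⇒x≡y; ∉⊥; ⊥⊆; p⊆p∪q; p⊆q⇒∣p∣≤∣q∣; p⊂q⇒∣p∣<∣q∣; ∣p∩q∣≤∣p∣; ∣⊥∣≡0)
open import Data.Fin.Properties using (all?; any?)
open import Data.Vec using ([]; _∷_; lookup)
open import Data.Vec.Properties using (lookup⇒[]=; []=⇒lookup)
open import Data.Vec.Functional using (updateAt)
open import Data.Vec.Functional.Properties using (updateAt-updates; updateAt-minimal)
open import Data.Maybe using (just; nothing; maybe′)
open import Data.Product using (_,_; proj₁; proj₂)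
open import Data.Sum using (_⊎_; inj₁; inj₂; swap)
open import Data.Empty using (⊥-elim)
open import Function using (const; _∘_; case_of_)
open import Relation.Nullary using (Dec; yes; no; ¬_)
open import Relation.Nullary.Decidable using (_×-dec_; _⊎-dec_; _→-dec_)
open import Relation.Binary.PropositionalEquality

-- §1  Rational arithmetic

module _ where
  open ℚS.+-*-Solver

  ½*[x+x]≡x : ∀ x → ½ *ℚ (x +ℚ x) ≡ x
  ½*[x+x]≡x = solve 1 (λ x → con ½ :* (x :+ x) := x) refl

  ½*[s+[s-d]]≡s-½*d : ∀ s d → ½ *ℚ (s +ℚ (s -ℚ d)) ≡ s -ℚ ½ *ℚ d
  ½*[s+[s-d]]≡s-½*d = solve 2 (λ s d → con ½ :* (s :+ (s :- d)) := s :- con ½ :* d) refl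

*-monoˡ-≤ : ∀ c {a b} → 0ℚ ≤ℚ c → a ≤ℚ b → c *ℚ a ≤ℚ c *ℚ b
*-monoˡ-≤ c 0≤c = ℚP.*-monoˡ-≤-nonNeg c {{nonNegative 0≤c}}

*-monoʳ-≤ : ∀ c {a b} → 0ℚ ≤ℚ c → a ≤ℚ b → a *ℚ c ≤ℚ b *ℚ c
*-monoʳ-≤ c 0≤c = ℚP.*-monoʳ-≤-nonNeg c {{nonNegative 0≤c}}

0≤*0≤ : ∀ {a b} → 0ℚ ≤ℚ a → 0ℚ ≤ℚ b → 0ℚ ≤ℚ a *ℚ b
0≤*0≤ {a} 0≤a 0≤b = ℚP.≤-trans (ℚP.≤-reflexive (sym (ℚP.*-zeroʳ a))) (*-monoˡ-≤ a 0≤a 0≤b)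

x-y≤x : ∀ x {y} → 0ℚ ≤ℚ y → x -ℚ y ≤ℚ x
x-y≤x x 0≤y = ℚP.≤-trans (ℚP.+-monoʳ-≤ x (ℚP.neg-antimono-≤ 0≤y)) (ℚP.≤-reflexive (ℚP.+-identityʳ x))

x≤1⇒x-1≤0 : ∀ {x} → x ≤ℚ 1ℚ → x -ℚ 1ℚ ≤ℚ 0ℚ
x≤1⇒x-1≤0 x≤1 = ℚP.≤-trans (ℚP.+-monoˡ-≤ _ x≤1) (ℚP.≤-reflexive (ℚP.+-inverseʳ 1ℚ))

0≤½ : 0ℚ ≤ℚ ½
0≤½ = *≤* (+≤+ z≤n)

½≤1 : ½ ≤ℚ 1ℚ
½≤1 = *≤* (+≤+ (s≤s z≤n))

½^-nonNeg : ∀ j → 0ℚ ≤ℚ ½ ^ℚ j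
½^-nonNeg zero    = ℚP.≤-trans 0≤½ ½≤1
½^-nonNeg (suc j) = 0≤*0≤ 0≤½ (½^-nonNeg j)

½^≤1 : ∀ j → ½ ^ℚ j ≤ℚ 1ℚ
½^≤1 zero    = ℚP.≤-refl
½^≤1 (suc j) = ℚP.≤-trans (*-monoˡ-≤ ½ 0≤½ (½^≤1 j))
                          (ℚP.≤-trans (ℚP.≤-reflexive (ℚP.*-identityʳ ½)) ½≤1)

½^-+ : ∀ a b → ½ ^ℚ (a + b) ≡ ½ ^ℚ a *ℚ ½ ^ℚ b
½^-+ zero    b = sym (ℚP.*-identityˡ (½ ^ℚ b))
½^-+ (suc a) b = trans (cong (½ *ℚ_) (½^-+ a b)) (sym (ℚP.*-assoc ½ (½ ^ℚ a) (½ ^ℚ b)))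

toℚ-nonNeg : ∀ m → 0ℚ ≤ℚ toℚ m
toℚ-nonNeg m = ℚP.nonNegative⁻¹ (toℚ m) {{ℚP.normalize-nonNeg m 1}}

-- (checked on unnormalised representatives, where it is a cross-multiplication)
toℚ-suc : ∀ m → toℚ (suc m) ≡ toℚ m +ℚ 1ℚ
toℚ-suc m = ℚP.toℚᵘ-injective (begin
    toℚᵘ (toℚ (suc m))                    ≈⟨ ℚP.toℚᵘ-fromℚᵘ (mkℚᵘ (+ suc m) 0) ⟩
    mkℚᵘ (+ suc m) 0                      ≈⟨ *≡* (sucᵘ (+ m)) ⟩
    mkℚᵘ (+ m) 0 +ᵘ mkℚᵘ (+ 1) 0          ≈⟨ ℚᵘP.≃-sym (ℚᵘP.+-cong (ℚP.toℚᵘ-fromℚᵘ (mkℚᵘ (+ m) 0))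
                                                                (ℚP.toℚᵘ-fromℚᵘ (mkℚᵘ (+ 1) 0))) ⟩
    toℚᵘ (toℚ m) +ᵘ toℚᵘ 1ℚ               ≈⟨ ℚᵘP.≃-sym (ℚP.toℚᵘ-homo-+ (toℚ m) 1ℚ) ⟩
    toℚᵘ (toℚ m +ℚ 1ℚ)                    ∎)
  where
  open ℚᵘP.≃-Reasoning
  open ℤS.+-*-Solver
  sucᵘ : ∀ x → (+ 1 +ℤ x) *ℤ + 1 ≡ (x *ℤ + 1 +ℤ + 1 *ℤ + 1) *ℤ (+ 1 *ℤ + 1)
  sucᵘ = solve 1 (λ x → (con (+ 1) :+ x) :* con (+ 1)
                      := (x :* con (+ 1) :+ con (+ 1) :* con (+ 1)) :* (con (+ 1) :* con (+ 1))) refl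

-- m·2^-m ≤ 1, by induction: (m+1)·2^-(m+1) = ½·(m·2^-m + 2^-m)
toℚ*½^≤1 : ∀ m → toℚ m *ℚ ½ ^ℚ m ≤ℚ 1ℚ
toℚ*½^≤1 zero    = ℚP.≤-trans (ℚP.≤-reflexive (ℚP.*-zeroˡ 1ℚ)) (ℚP.≤-trans 0≤½ ½≤1)
toℚ*½^≤1 (suc m) = begin
    toℚ (suc m) *ℚ (½ *ℚ h)       ≡⟨ cong (_*ℚ (½ *ℚ h)) (toℚ-suc m) ⟩
    (toℚ m +ℚ 1ℚ) *ℚ (½ *ℚ h)     ≡⟨ regroup (toℚ m) h ⟩
    ½ *ℚ (toℚ m *ℚ h +ℚ h)        ≤⟨ *-monoˡ-≤ ½ 0≤½ (ℚP.+-mono-≤ (toℚ*½^≤1 m) (½^≤1 m)) ⟩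
    ½ *ℚ (1ℚ +ℚ 1ℚ)               ≡⟨ ½*[x+x]≡x 1ℚ ⟩
    1ℚ                            ∎
  where
  h : ℚ
  h = ½ ^ℚ m
  open ℚP.≤-Reasoning
  open ℚS.+-*-Solver
  regroup : ∀ a h → (a +ℚ 1ℚ) *ℚ (½ *ℚ h) ≡ ½ *ℚ (a *ℚ h +ℚ h)
  regroup = solve 2 (λ a h → (a :+ con 1ℚ) :* (con ½ :* h) := con ½ :* (a :* h :+ h)) refl

-- The success bound after f rounds, each failing with probability ≤ ε;
-- it is at most 1, and one more failure chance ε moves it from f to f + 1.
1-f*ε : ℚ → ℕ → ℚ
1-f*ε ε f = 1ℚ -ℚ toℚ f *ℚ ε

1-f*ε≤1 : ∀ {ε} → 0ℚ ≤ℚ ε → ∀ f → 1-f*ε ε f ≤ℚ 1ℚ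
1-f*ε≤1 0≤ε f = x-y≤x 1ℚ (0≤*0≤ (toℚ-nonNeg f) 0≤ε)

1-f*ε-suc : ∀ ε f → 1-f*ε ε f -ℚ ε ≡ 1-f*ε ε (suc f)
1-f*ε-suc ε f = trans (shift (toℚ f) ε) (cong (λ x → 1ℚ -ℚ x *ℚ ε) (sym (toℚ-suc f)))
  where
  open ℚS.+-*-Solver
  shift : ∀ a e → (1ℚ -ℚ a *ℚ e) -ℚ e ≡ 1ℚ -ℚ (a +ℚ 1ℚ) *ℚ e
  shift = solve 2 (λ a e → (con 1ℚ :- a :* e) :- e := con 1ℚ :- (a :+ con 1ℚ) :* e) refl

-- With ε = 2^-2k: success probability ≥ 1 - kε means failure·k ≤ (k·2^-k)² ≤ 1.
failure*k≤1 : ∀ k p → 1-f*ε (½ ^ℚ (k + k)) k ≤ℚ p → ((1ℚ -ℚ p) ^ℚ 1) *ℚ toℚ k ≤ℚ 1ℚ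
failure*k≤1 k p bound≤p = begin
    ((1ℚ -ℚ p) ^ℚ 1) *ℚ toℚ k                       ≡⟨ cong (_*ℚ toℚ k) (ℚP.*-identityʳ (1ℚ -ℚ p)) ⟩
    (1ℚ -ℚ p) *ℚ toℚ k                              ≤⟨ *-monoʳ-≤ (toℚ k) (toℚ-nonNeg k)
                                                        (ℚP.+-monoʳ-≤ 1ℚ (ℚP.neg-antimono-≤ bound≤p)) ⟩
    (1ℚ -ℚ (1ℚ -ℚ toℚ k *ℚ ½ ^ℚ (k + k))) *ℚ toℚ k  ≡⟨ cong (λ e → (1ℚ -ℚ (1ℚ -ℚ toℚ k *ℚ e)) *ℚ toℚ k) (½^-+ k k) ⟩
    (1ℚ -ℚ (1ℚ -ℚ toℚ k *ℚ (h *ℚ h))) *ℚ toℚ k      ≡⟨ square (toℚ k) h ⟩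
    (toℚ k *ℚ h) *ℚ (toℚ k *ℚ h)                    ≤⟨ *-monoʳ-≤ _ (0≤*0≤ (toℚ-nonNeg k) (½^-nonNeg k)) (toℚ*½^≤1 k) ⟩
    1ℚ *ℚ (toℚ k *ℚ h)                              ≡⟨ ℚP.*-identityˡ _ ⟩
    toℚ k *ℚ h                                      ≤⟨ toℚ*½^≤1 k ⟩
    1ℚ                                              ∎
  where
  h : ℚ
  h = ½ ^ℚ k
  open ℚP.≤-Reasoning
  open ℚS.+-*-Solver
  square : ∀ a h → (1ℚ -ℚ (1ℚ -ℚ a *ℚ (h *ℚ h))) *ℚ a ≡ (a *ℚ h) *ℚ (a *ℚ h)
  square = solve 2 (λ a h → (con 1ℚ :- (con 1ℚ :- a :* (h :* h))) :* a := (a :* h) :* (a :* h)) refl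

-- §2  Random subsets, success probabilities, amplification

randomSubset : ∀ {n} m → (Subset m → Alg n) → Alg n
randomSubset zero    L = L []
randomSubset (suc m) L = coin (λ b → randomSubset m (λ A → L (b ∷ A)))

repeatTrials : ∀ {n} m → ℕ → (Subset m → Alg n → Alg n) → Alg n → Alg n
repeatTrials m zero    trial e = e
repeatTrials m (suc j) trial e = randomSubset m (λ A → trial A (repeatTrials m j trial e))

Separates : ∀ {m} → Subset m → Fin m → Fin m → Set
Separates A u v = lookup A u ≢ lookup A v

module Success {n} (P : Subset n → Set) (O : Oracle n) where

  Pr[_]≥_ : Alg n → ℚ → Set
  Pr[ t ]≥ p = ∃[ p′ ] GoodMass P O t p′ × p ≤ℚ p′

  -- the empty set of executions has mass 0, so bounds ≤ 0 are trivial
  massZero : ∀ t → GoodMass P O t 0ℚ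
  massZero (ret S)       = ret-any
  massZero (coin f)      = coin (massZero (f true)) (massZero (f false))
  massZero (query A B h) = query (massZero (h (O A B)))

  Pr≥-nonPos : ∀ {t p} → p ≤ℚ 0ℚ → Pr[ t ]≥ p
  Pr≥-nonPos {t} p≤0 = 0ℚ , massZero t , p≤0

  Pr≥-mono : ∀ {t p q} → Pr[ t ]≥ p → q ≤ℚ p → Pr[ t ]≥ q
  Pr≥-mono (p′ , mass , p≤p′) q≤p = p′ , mass , ℚP.≤-trans q≤p p≤p′

  Pr≥-≡ : ∀ {t p q} → p ≡ q → Pr[ t ]≥ p → Pr[ t ]≥ q
  Pr≥-≡ {t} = subst (Pr[ t ]≥_)

  Pr≥-ret : ∀ {S} → P S → Pr[ ret S ]≥ 1ℚ
  Pr≥-ret PS = 1ℚ , ret-good PS , ℚP.≤-refl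

  Pr≥-coin : ∀ {f p q} → Pr[ f true ]≥ p → Pr[ f false ]≥ q → Pr[ coin f ]≥ (½ *ℚ (p +ℚ q))
  Pr≥-coin (p′ , mp , p≤p′) (q′ , mq , q≤q′) =
    _ , coin mp mq , *-monoˡ-≤ ½ 0≤½ (ℚP.+-mono-≤ p≤p′ q≤q′)

  Pr≥-query : ∀ {A B h p} → (∀ ans → O A B ≡ ans → Pr[ h ans ]≥ p) → Pr[ query A B h ]≥ p
  Pr≥-query {A} {B} bound with bound (O A B) refl
  ... | p′ , mass , p≤p′ = p′ , query mass , p≤p′

  Pr≥-first-coin : ∀ m {L : Subset (suc m) → Alg n} {c} →
    (∀ b₀ → Pr[ randomSubset m (λ A → L (b₀ ∷ A)) ]≥ c) → Pr[ randomSubset (suc m) L ]≥ c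
  Pr≥-first-coin m {c = c} both = Pr≥-≡ (½*[x+x]≡x c) (Pr≥-coin (both true) (both false))

  Pr≥-random : ∀ m {L : Subset m → Alg n} {c} → (∀ A → Pr[ L A ]≥ c) → Pr[ randomSubset m L ]≥ c
  Pr≥-random zero    all = all []
  Pr≥-random (suc m) {L} all = Pr≥-first-coin m {L} (λ b₀ → Pr≥-random m (λ A → all (b₀ ∷ A)))

  Pr≥-random-bit : ∀ m (v : Fin m) (c : Bool) {L : Subset m → Alg n} a b →
    (∀ A → Pr[ L A ]≥ b) → (∀ A → lookup A v ≢ c → Pr[ L A ]≥ a) →
    Pr[ randomSubset m L ]≥ (½ *ℚ (a +ℚ b))
  Pr≥-random-bit (suc m) zero true a b all differ =
    Pr≥-≡ (cong (½ *ℚ_) (ℚP.+-comm b a))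
      (Pr≥-coin (Pr≥-random m (λ A → all (true ∷ A))) (Pr≥-random m (λ A → differ (false ∷ A) (λ ()))))
  Pr≥-random-bit (suc m) zero false a b all differ =
    Pr≥-coin (Pr≥-random m (λ A → differ (true ∷ A) (λ ()))) (Pr≥-random m (λ A → all (false ∷ A)))
  Pr≥-random-bit (suc m) (suc v) c {L} a b all differ = Pr≥-first-coin m {L} (λ b₀ →
    Pr≥-random-bit m v c a b (λ A → all (b₀ ∷ A)) (λ A → differ (b₀ ∷ A)))

  Pr≥-random-separates : ∀ m {u v : Fin m} → u ≢ v → {L : Subset m → Alg n} → ∀ a b →
    (∀ A → Pr[ L A ]≥ b) → (∀ A → Separates A u v → Pr[ L A ]≥ a) →
    Pr[ randomSubset m L ]≥ (½ *ℚ (a +ℚ b))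
  Pr≥-random-separates (suc m) {zero}  {zero}  u≢v a b all sep = ⊥-elim (u≢v refl)
  Pr≥-random-separates (suc m) {zero}  {suc v} u≢v {L} a b all sep = Pr≥-first-coin m {L} (λ b₀ →
    Pr≥-random-bit m v b₀ a b (λ A → all (b₀ ∷ A)) (λ A v≢b₀ → sep (b₀ ∷ A) (v≢b₀ ∘ sym)))
  Pr≥-random-separates (suc m) {suc u} {zero}  u≢v {L} a b all sep = Pr≥-first-coin m {L} (λ b₀ →
    Pr≥-random-bit m u b₀ a b (λ A → all (b₀ ∷ A)) (λ A → sep (b₀ ∷ A)))
  Pr≥-random-separates (suc m) {suc u} {suc v} u≢v {L} a b all sep = Pr≥-first-coin m {L} (λ b₀ →
    Pr≥-random-separates m (u≢v ∘ cong suc) a b (λ A → all (b₀ ∷ A)) (λ A → sep (b₀ ∷ A)))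

  Pr≥-repeat : ∀ m j {trial : Subset m → Alg n → Alg n} {e c} → Pr[ e ]≥ c →
    (∀ A {t} → Pr[ t ]≥ c → Pr[ trial A t ]≥ c) → Pr[ repeatTrials m j trial e ]≥ c
  Pr≥-repeat m zero    e≥c preserve = e≥c
  Pr≥-repeat m (suc j) e≥c preserve = Pr≥-random m (λ A → preserve A (Pr≥-repeat m j e≥c preserve))

  Pr≥-amplify : ∀ m {trial : Subset m → Alg n → Alg n} {e} {u v : Fin m} {s} → u ≢ v → s ≤ℚ 1ℚ →
    (∀ A {t c} → c ≤ℚ s → Pr[ t ]≥ c → Pr[ trial A t ]≥ c) →
    (∀ A t → Separates A u v → Pr[ trial A t ]≥ s) →
    ∀ j → Pr[ repeatTrials m j trial e ]≥ (s -ℚ ½ ^ℚ j)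
  Pr≥-amplify m u≢v s≤1 preserve hit zero    = Pr≥-nonPos (x≤1⇒x-1≤0 s≤1)
  Pr≥-amplify m {s = s} u≢v s≤1 preserve hit (suc j) =
    Pr≥-≡ (½*[s+[s-d]]≡s-½*d s (½ ^ℚ j))
      (Pr≥-random-separates m u≢v s (s -ℚ ½ ^ℚ j)
        (λ A → preserve A (x-y≤x s (½^-nonNeg j)) (Pr≥-amplify m u≢v s≤1 preserve hit j))
        (λ A → hit A _))

-- §3  Counting queries

module Cost {n} (O : Oracle n) where

  queries-random : ∀ m {L : Subset m → Alg n} {b} → (∀ A → queries O (L A) ≤ b) →
                   queries O (randomSubset m L) ≤ b
  queries-random zero    bound = bound []
  queries-random (suc m) bound = ℕP.⊔-lub (queries-random m (λ A → bound (true ∷ A)))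
                                          (queries-random m (λ A → bound (false ∷ A)))

  queries-repeat : ∀ m j {trial : Subset m → Alg n → Alg n} {e B} → queries O e ≤ B →
    (∀ A {t b} → queries O t ≤ b → B ≤ b → queries O (trial A t) ≤ suc b) →
    queries O (repeatTrials m j trial e) ≤ j + B
  queries-repeat m zero    e≤B step = e≤B
  queries-repeat m (suc j) e≤B step =
    queries-random m (λ A → step A (queries-repeat m j e≤B step) (ℕP.m≤n+m _ j))

-- §4  The algorithm

module Algorithm (n k : ℕ) where

  -- vertices other than x and outside M: where unlearned neighbours of x lie
  unexplored : Fin n → Subset n → Subset n
  unexplored x M = ∁ (⁅ x ⁆ ∪ M)

  explore : ℕ → Fin n → Subset n → (Subset n → Alg n) → Alg n
  explore zero    x M c = c M
  explore (suc m) x M c with nonempty? (unexplored x M)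
  ... | no _  = c M
  ... | yes _ = query ⁅ x ⁆ (unexplored x M)
                  (maybe′ (λ edge → explore m x (M ∪ ⁅ proj₂ edge ⁆) c) (c M))

  edgeTrial : Subset n → (Fin n → Fin n → Alg n) → Subset n → Alg n → Alg n
  edgeTrial U g A t with nonempty? (A ∩ U) | nonempty? (∁ A ∩ U)
  ... | yes _ | yes _ = query (A ∩ U) (∁ A ∩ U) (maybe′ (λ edge → g (proj₁ edge) (proj₂ edge)) t)
  ... | _     | _     = t

  CoversLearned : (Fin n → Subset n) → Subset n → Set
  CoversLearned N S = (∀ z y → y ∈ N z → z ∈ S ⊎ y ∈ S) × ∣ S ∣ ≤ k

  coversLearned? : ∀ N S → Dec (CoversLearned N S)
  coversLearned? N S =
    all? (λ z → all? (λ y → (y ∈? N z) →-dec ((z ∈? S) ⊎-dec (y ∈? S)))) ×-dec (∣ S ∣ ℕP.≤? k)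

  coverLearned : (Fin n → Subset n) → Alg n
  coverLearned N with anySubset? (coversLearned? N)
  ... | yes (S , _) = ret S
  ... | no _        = ret ⊥

  -- X: processed vertices; N z: learned neighbours of z; f: rounds left
  mutual
    round : ℕ → Subset n → (Fin n → Subset n) → Alg n
    round zero    X N = coverLearned N
    round (suc f) X N = repeatTrials n (k + k) (edgeTrial (∁ X) (processEdge f X N)) (coverLearned N)

    processEdge : ℕ → Subset n → (Fin n → Subset n) → Fin n → Fin n → Alg n
    processEdge f X N x y =
      explore (suc k) x ⊥ (λ Mx → explore (suc k) y ⊥ (λ My →
        round f ((X ∪ ⁅ x ⁆) ∪ ⁅ y ⁆) (updateAt (updateAt N x (const Mx)) y (const My))))

  alg : Alg n
  alg = round k ⊥ (const ⊥)

  perRound : ℕ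
  perRound = (k + k) + (suc k + suc k)

  module Queries (O : Oracle n) where
    open Cost O

    queries-explore : ∀ m x M {c b} → (∀ M′ → queries O (c M′) ≤ b) → queries O (explore m x M c) ≤ m + b
    queries-explore zero    x M bound = bound M
    queries-explore (suc m) x M bound with nonempty? (unexplored x M)
    ... | no _ = ℕP.m≤n⇒m≤o+n (suc m) (bound M)
    ... | yes _ with O ⁅ x ⁆ (unexplored x M)
    ...   | nothing         = s≤s (ℕP.m≤n⇒m≤o+n m (bound M))
    ...   | just (_ , y)    = s≤s (queries-explore m x (M ∪ ⁅ y ⁆) bound)

    queries-edgeTrial : ∀ U {g} A {t b} → (∀ x y → queries O (g x y) ≤ b) → queries O t ≤ b →
                        queries O (edgeTrial U g A t) ≤ suc b
    queries-edgeTrial U A g≤b t≤b with nonempty? (A ∩ U) | nonempty? (∁ A ∩ U)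
    ... | no _  | _     = ℕP.m≤n⇒m≤1+n t≤b
    ... | yes _ | no _  = ℕP.m≤n⇒m≤1+n t≤b
    ... | yes _ | yes _ with O (A ∩ U) (∁ A ∩ U)
    ...   | nothing       = s≤s t≤b
    ...   | just (x , y)  = s≤s (g≤b x y)

    queries-coverLearned : ∀ N → queries O (coverLearned N) ≡ 0
    queries-coverLearned N with anySubset? (coversLearned? N)
    ... | yes _ = refl
    ... | no _  = refl

    -- each round: 2k trials, then two explorations of k+1 queries each
    queries-round : ∀ f X N → queries O (round f X N) ≤ f * perRound
    queries-round zero    X N = ℕP.≤-reflexive (queries-coverLearned N)
    queries-round (suc f) X N = ℕP.≤-trans
      (queries-repeat n (k + k) (ℕP.≤-trans (ℕP.≤-reflexive (queries-coverLearned N)) z≤n)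
        (λ A t≤b B≤b → queries-edgeTrial (∁ X) A (λ x y → ℕP.≤-trans (processEdge≤ x y) B≤b) t≤b))
      (ℕP.≤-reflexive regroup)
      where
      regroup : (k + k) + (suc k + (suc k + f * perRound)) ≡ suc f * perRound
      regroup = trans (cong (λ b → (k + k) + b) (sym (ℕP.+-assoc (suc k) (suc k) (f * perRound))))
                      (sym (ℕP.+-assoc (k + k) (suc k + suc k) (f * perRound)))
      processEdge≤ : ∀ x y → queries O (processEdge f X N x y) ≤ suc k + (suc k + f * perRound)
      processEdge≤ x y = queries-explore (suc k) x ⊥ (λ Mx →
                           queries-explore (suc k) y ⊥ (λ My → queries-round f _ _))

-- §5  Analysis for a fixed graph G with a BISE oracle O and a cover K, |K| ≤ k

updateAt-pointwise : ∀ {A : Set} {m} (Q : Fin m → A → Set) (xs : Fin m → A) x a →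
  Q x a → (∀ z → z ≢ x → Q z (xs z)) → ∀ z → Q z (updateAt xs x (const a) z)
updateAt-pointwise Q xs x a Qxa Qrest z with z ≟ᶠ x
... | yes refl = subst (Q x) (sym (updateAt-updates x xs)) Qxa
... | no z≢x   = subst (Q z) (sym (updateAt-minimal z x xs z≢x)) (Qrest z z≢x)

∈⇒0<∣∣ : ∀ {m} {p : Subset m} {x} → x ∈ p → 0 < ∣ p ∣
∈⇒0<∣∣ {m} {p} x∈p = subst (_< ∣ p ∣) (∣⊥∣≡0 m) (p⊂q⇒∣p∣<∣q∣ (⊥⊆ , _ , x∈p , ∉⊥))

∣p∣<∣p∪⁅y⁆∣ : ∀ {m} {p : Subset m} {y} → y ∉ p → ∣ p ∣ < ∣ p ∪ ⁅ y ⁆ ∣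
∣p∣<∣p∪⁅y⁆∣ {y = y} y∉p = p⊂q⇒∣p∣<∣q∣ (p⊆p∪q _ , y , x∈p∪q⁺ (inj₂ (x∈⁅x⁆ y)) , y∉p)

module Analysis (n k : ℕ) (G : Graph n) (O : Oracle n) (bise : IsBISE G O)
                (K : Subset n) (K-cover : IsVertexCover G K) (∣K∣≤k : ∣ K ∣ ≤ k) where
  open Algorithm n k

  SmallCover : Subset n → Set
  SmallCover S = IsVertexCover G S × ∣ S ∣ ≤ k

  open Success SmallCover O

  edge-irrefl : ∀ {u v} → Edge G u v → u ≢ v
  edge-irrefl {u} e refl with trans (sym e) (adj-irr G u)
  ... | ()

  edge-sym : ∀ {u v} → Edge G u v → Edge G v u
  edge-sym {u} {v} e = trans (adj-sym G v u) e

  -- Neighbourhood knowledge about a vertex x: M contains only neighbours;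
  -- M contains all of them; M is complete or so large that x is forced.
  OnlyNeighbours AllNeighbours Saturated : Fin n → Subset n → Set
  OnlyNeighbours x M = ∀ y → y ∈ M → Edge G x y
  AllNeighbours  x M = ∀ y → Edge G x y → y ∈ M
  Saturated      x M = AllNeighbours x M ⊎ k < ∣ M ∣

  -- If S (|S| ≤ k) covers the edges from z into a saturated M, it covers all
  -- edges at z: otherwise M ⊆ S, contradicting |M| > k.
  saturated-covered : ∀ {z M S} → Saturated z M → (∀ y → y ∈ M → z ∈ S ⊎ y ∈ S) → ∣ S ∣ ≤ k →
                      ∀ y → Edge G z y → z ∈ S ⊎ y ∈ S
  saturated-covered (inj₁ all) covers _ y e = covers y (all y e)
  saturated-covered {z} {M} {S} (inj₂ large) covers ∣S∣≤k y e with z ∈? S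
  ... | yes z∈S = inj₁ z∈S
  ... | no z∉S  = ⊥-elim (ℕP.<⇒≱ large (ℕP.≤-trans (p⊆q⇒∣p∣≤∣q∣ M⊆S) ∣S∣≤k))
    where
    M⊆S : M ⊆ S
    M⊆S {w} w∈M with covers w w∈M
    ... | inj₁ z∈S = ⊥-elim (z∉S z∈S)
    ... | inj₂ w∈S = w∈S

  Invariant : Subset n → (Fin n → Subset n) → Set
  Invariant X N = (∀ z → OnlyNeighbours z (N z)) × (∀ z → z ∈ X → Saturated z (N z))

  invariant-init : Invariant ⊥ (const ⊥)
  invariant-init = (λ z y y∈⊥ → ⊥-elim (∉⊥ y∈⊥)) , (λ z z∈⊥ → ⊥-elim (∉⊥ z∈⊥))

  invariant-process : ∀ {X N x M} → Invariant X N → OnlyNeighbours x M → Saturated x M →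
                      Invariant (X ∪ ⁅ x ⁆) (updateAt N x (const M))
  invariant-process {X} {N} {x} {M} (only , saturated) onlyM saturatedM =
      updateAt-pointwise OnlyNeighbours N x M onlyM (λ z _ → only z)
    , λ z → updateAt-pointwise (λ z M′ → z ∈ X ∪ ⁅ x ⁆ → Saturated z M′) N x M (λ _ → saturatedM)
              (λ z z≢x z∈ → saturated z (inX z≢x z∈)) z
    where
    inX : ∀ {z} → z ≢ x → z ∈ X ∪ ⁅ x ⁆ → z ∈ X
    inX z≢x z∈ with x∈p∪q⁻ X ⁅ x ⁆ z∈
    ... | inj₁ z∈X = z∈X
    ... | inj₂ z∈x = ⊥-elim (z≢x (x∈⁅y⁆⇒x≡y x z∈x))

  -- progress measure: vertices of K not yet processed
  remaining : Subset n → ℕ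
  remaining X = ∣ K ∩ ∁ X ∣

  remaining-init : remaining ⊥ ≤ k
  remaining-init = ℕP.≤-trans (∣p∩q∣≤∣p∣ K (∁ ⊥)) ∣K∣≤k

  remaining-decreases : ∀ {X X′ w} → X ⊆ X′ → w ∈ K → w ∉ X → w ∈ X′ → remaining X′ < remaining X
  remaining-decreases {X} {X′} {w} X⊆X′ w∈K w∉X w∈X′ =
    p⊂q⇒∣p∣<∣q∣ (shrink , w , x∈p∩q⁺ (w∈K , x∉p⇒x∈∁p w∉X) , λ w∈ → x∈∁p⇒x∉p (proj₂ (x∈p∩q⁻ K _ w∈)) w∈X′)
    where
    shrink : K ∩ ∁ X′ ⊆ K ∩ ∁ X
    shrink z∈ with x∈p∩q⁻ K (∁ X′) z∈
    ... | z∈K , z∉X′ = x∈p∩q⁺ (z∈K , x∉p⇒x∈∁p (λ z∈X → x∈∁p⇒x∉p z∉X′ (X⊆X′ z∈X)))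

  NoEdgeOutside : Subset n → Set
  NoEdgeOutside X = ∀ u v → u ∈ ∁ X → v ∈ ∁ X → ¬ Edge G u v

  edgeOutside? : ∀ X → Dec (∃[ u ] ∃[ v ] u ∈ ∁ X × v ∈ ∁ X × Edge G u v)
  edgeOutside? X = any? (λ u → any? (λ v → (u ∈? ∁ X) ×-dec (v ∈? ∁ X) ×-dec (adj G u v ≟ᵇ true)))

  no-remaining⇒no-edge : ∀ {X} → remaining X ≤ 0 → NoEdgeOutside X
  no-remaining⇒no-edge {X} none u v u∈∁X v∈∁X e with K-cover u v e
  ... | inj₁ u∈K = ℕP.<⇒≱ (∈⇒0<∣∣ (x∈p∩q⁺ (u∈K , u∈∁X))) none
  ... | inj₂ v∈K = ℕP.<⇒≱ (∈⇒0<∣∣ (x∈p∩q⁺ (v∈K , v∈∁X))) none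

  K-coversLearned : ∀ {X N} → Invariant X N → CoversLearned N K
  K-coversLearned (only , _) = (λ z y y∈ → K-cover z y (only z y y∈)) , ∣K∣≤k

  learned-cover-is-cover : ∀ {X N S} → Invariant X N → NoEdgeOutside X → CoversLearned N S → IsVertexCover G S
  learned-cover-is-cover {X} {N} {S} (_ , saturated) noEdge (covers , ∣S∣≤k) u v e
    with u ∈? X | v ∈? X
  ... | yes u∈X | _       = saturated-covered (saturated u u∈X) (covers u) ∣S∣≤k v e
  ... | no _    | yes v∈X = swap (saturated-covered (saturated v v∈X) (covers v) ∣S∣≤k u (edge-sym e))
  ... | no u∉X  | no v∉X  = ⊥-elim (noEdge u v (x∉p⇒x∈∁p u∉X) (x∉p⇒x∈∁p v∉X) e)

  coverLearned-correct : ∀ {X N} → Invariant X N → NoEdgeOutside X → Pr[ coverLearned N ]≥ 1ℚ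
  coverLearned-correct {X} {N} inv noEdge with anySubset? (coversLearned? N)
  ... | yes (S , candidate) = Pr≥-ret (learned-cover-is-cover inv noEdge candidate , proj₂ candidate)
  ... | no none             = ⊥-elim (none (K , K-coversLearned inv))

  bise-found : ∀ {A B} → Disjoint A B → Nonempty A → Nonempty B →
               ∀ {u v} → O A B ≡ just (u , v) → u ∈ A × v ∈ B × Edge G u v
  bise-found disjoint neA neB = proj₁ (bise _ _ disjoint neA neB) _ _

  bise-none : ∀ {A B} → Disjoint A B → Nonempty A → Nonempty B →
              O A B ≡ nothing → ∀ u v → u ∈ A → v ∈ B → ¬ Edge G u v
  bise-none disjoint neA neB = proj₂ (bise _ _ disjoint neA neB)

  x-unexplored-disjoint : ∀ x M → Disjoint ⁅ x ⁆ (unexplored x M)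
  x-unexplored-disjoint x M w w∈x w∈ = x∈∁p⇒x∉p w∈ (x∈p∪q⁺ (inj₁ w∈x))

  unexplored-neighbour : ∀ {x y M} → Edge G x y → y ∉ M → y ∈ unexplored x M
  unexplored-neighbour {x} {y} {M} e y∉M = x∉p⇒x∈∁p λ y∈ → excluded (x∈p∪q⁻ ⁅ x ⁆ M y∈)
    where
    excluded : ¬ (y ∈ ⁅ x ⁆ ⊎ y ∈ M)
    excluded (inj₁ y∈x) = edge-irrefl e (sym (x∈⁅y⁆⇒x≡y x y∈x))
    excluded (inj₂ y∈M) = y∉M y∈M

  all-learned : ∀ {x M} → (∀ y → y ∈ unexplored x M → ¬ Edge G x y) → AllNeighbours x M
  all-learned {x} {M} noNew y e with y ∈? M
  ... | yes y∈M = y∈M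
  ... | no y∉M  = ⊥-elim (noNew y (unexplored-neighbour e y∉M) e)

  learn-neighbour : ∀ {x M y} → OnlyNeighbours x M → Edge G x y → OnlyNeighbours x (M ∪ ⁅ y ⁆)
  learn-neighbour {x} {M} {y} only e w w∈ with x∈p∪q⁻ M ⁅ y ⁆ w∈
  ... | inj₁ w∈M = only w w∈M
  ... | inj₂ w∈y = subst (Edge G x) (sym (x∈⁅y⁆⇒x≡y y w∈y)) e

  -- Each step learns a new neighbour, so after m steps either the
  -- neighbourhood is complete or more than k neighbours are known.
  explore-correct : ∀ m x M {c p} → OnlyNeighbours x M → suc k ≤ ∣ M ∣ + m →
    (∀ M′ → OnlyNeighbours x M′ → Saturated x M′ → Pr[ c M′ ]≥ p) → Pr[ explore m x M c ]≥ p
  explore-correct zero x M only enough next =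
    next M only (inj₂ (subst (suc k ≤_) (ℕP.+-identityʳ ∣ M ∣) enough))
  explore-correct (suc m) x M {c} {p} only enough next with nonempty? (unexplored x M)
  ... | no nothingLeft = next M only (inj₁ (all-learned (λ y y∈ _ → nothingLeft (y , y∈))))
  ... | yes someLeft   = Pr≥-query answer
    where
    disjoint : Disjoint ⁅ x ⁆ (unexplored x M)
    disjoint = x-unexplored-disjoint x M
    answer : ∀ ans → O ⁅ x ⁆ (unexplored x M) ≡ ans →
             Pr[ maybe′ (λ edge → explore m x (M ∪ ⁅ proj₂ edge ⁆) c) (c M) ans ]≥ p
    answer nothing none =
      next M only (inj₁ (all-learned (λ y y∈ → bise-none disjoint (x , x∈⁅x⁆ x) someLeft none x y (x∈⁅x⁆ x) y∈)))
    answer (just (u , y)) found with bise-found disjoint (x , x∈⁅x⁆ x) someLeft found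
    ... | u∈x , y∈ , e = explore-correct m x (M ∪ ⁅ y ⁆) (learn-neighbour only xy) enough′ next
      where
      xy : Edge G x y
      xy = subst (λ w → Edge G w y) (x∈⁅y⁆⇒x≡y x u∈x) e
      y∉M : y ∉ M
      y∉M y∈M = x∈∁p⇒x∉p y∈ (x∈p∪q⁺ (inj₂ y∈M))
      enough′ : suc k ≤ ∣ M ∪ ⁅ y ⁆ ∣ + m
      enough′ = ℕP.≤-trans enough (ℕP.≤-trans (ℕP.≤-reflexive (ℕP.+-suc ∣ M ∣ m))
                                              (ℕP.+-monoˡ-≤ m (∣p∣<∣p∪⁅y⁆∣ y∉M)))

  EdgesReach : Subset n → (Fin n → Fin n → Alg n) → ℚ → Set
  EdgesReach U g c = ∀ x y → x ∈ U → y ∈ U → Edge G x y → Pr[ g x y ]≥ c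

  EdgesReach-mono : ∀ {U g c d} → EdgesReach U g c → d ≤ℚ c → EdgesReach U g d
  EdgesReach-mono reach d≤c x y x∈ y∈ e = Pr≥-mono (reach x y x∈ y∈ e) d≤c

  split-disjoint : ∀ (A U : Subset n) → Disjoint (A ∩ U) (∁ A ∩ U)
  split-disjoint A U x x∈A∩U x∈∁A∩U = x∈∁p⇒x∉p (proj₁ (x∈p∩q⁻ (∁ A) U x∈∁A∩U)) (proj₁ (x∈p∩q⁻ A U x∈A∩U))

  edgeTrial-answer : ∀ U {g} A {t c} (neA : Nonempty (A ∩ U)) (neB : Nonempty (∁ A ∩ U)) →
    EdgesReach U g c → (O (A ∩ U) (∁ A ∩ U) ≡ nothing → Pr[ t ]≥ c) →
    Pr[ query (A ∩ U) (∁ A ∩ U) (maybe′ (λ edge → g (proj₁ edge) (proj₂ edge)) t) ]≥ c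
  edgeTrial-answer U {g} A {t} {c} neA neB reach onNone = Pr≥-query answer
    where
    answer : ∀ ans → O (A ∩ U) (∁ A ∩ U) ≡ ans → Pr[ maybe′ (λ edge → g (proj₁ edge) (proj₂ edge)) t ans ]≥ c
    answer nothing none = onNone none
    answer (just (x , y)) found =
      let x∈ , y∈ , e = bise-found (split-disjoint A U) neA neB found
      in  reach x y (proj₂ (x∈p∩q⁻ A U x∈)) (proj₂ (x∈p∩q⁻ (∁ A) U y∈)) e

  edgeTrial-preserves : ∀ U {g} A {t c} → EdgesReach U g c → Pr[ t ]≥ c → Pr[ edgeTrial U g A t ]≥ c
  edgeTrial-preserves U A reach t≥c with nonempty? (A ∩ U) | nonempty? (∁ A ∩ U)
  ... | no _    | _       = t≥c
  ... | yes _   | no _    = t≥c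
  ... | yes neA | yes neB = edgeTrial-answer U A neA neB reach (const t≥c)

  edgeTrial-crossing : ∀ U {g} A {t c u v} → EdgesReach U g c →
    u ∈ A ∩ U → v ∈ ∁ A ∩ U → Edge G u v → Pr[ edgeTrial U g A t ]≥ c
  edgeTrial-crossing U A {u = u} {v} reach u∈ v∈ e with nonempty? (A ∩ U) | nonempty? (∁ A ∩ U)
  ... | no empty | _        = ⊥-elim (empty (u , u∈))
  ... | yes _    | no empty = ⊥-elim (empty (v , v∈))
  ... | yes neA  | yes neB  = edgeTrial-answer U A neA neB reach
                                (λ none → ⊥-elim (bise-none (split-disjoint A U) neA neB none u v u∈ v∈ e))

  separates-one : ∀ A {u v : Fin n} → Separates A u v → (u ∈ A × v ∉ A) ⊎ (v ∈ A × u ∉ A)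
  separates-one A {u} {v} sep with lookup A u in eqU | lookup A v in eqV
  ... | true  | true  = ⊥-elim (sep refl)
  ... | false | false = ⊥-elim (sep refl)
  ... | true  | false = inj₁ (lookup⇒[]= u A eqU , λ v∈ → case trans (sym ([]=⇒lookup v∈)) eqV of λ ())
  ... | false | true  = inj₂ (lookup⇒[]= v A eqV , λ u∈ → case trans (sym ([]=⇒lookup u∈)) eqU of λ ())

  edgeTrial-separating : ∀ U {g} A {t c u v} → EdgesReach U g c →
    u ∈ U → v ∈ U → Edge G u v → Separates A u v → Pr[ edgeTrial U g A t ]≥ c
  edgeTrial-separating U A reach u∈U v∈U e sep with separates-one A sep
  ... | inj₁ (u∈A , v∉A) = edgeTrial-crossing U A reach (x∈p∩q⁺ (u∈A , u∈U)) (x∈p∩q⁺ (x∉p⇒x∈∁p v∉A , v∈U)) e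
  ... | inj₂ (v∈A , u∉A) = edgeTrial-crossing U A reach (x∈p∩q⁺ (v∈A , v∈U)) (x∈p∩q⁺ (x∉p⇒x∈∁p u∉A , u∈U)) (edge-sym e)

  -- Processing a found edge xy of ∁ X keeps the invariant and decreases the
  -- measure (x or y lies in K), so the remaining rounds inherit their bound.
  processEdge-correct : ∀ f X N {p} → Invariant X N → remaining X ≤ suc f →
    (∀ X′ N′ → Invariant X′ N′ → remaining X′ ≤ f → Pr[ round f X′ N′ ]≥ p) →
    EdgesReach (∁ X) (processEdge f X N) p
  processEdge-correct f X N inv measure rounds x y x∈U y∈U e =
    explore-correct (suc k) x ⊥ nothingLearned noneYet λ Mx onlyX saturatedX →
    explore-correct (suc k) y ⊥ nothingLearned noneYet λ My onlyY saturatedY →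
    rounds _ _ (invariant-process (invariant-process inv onlyX saturatedX) onlyY saturatedY)
               (ℕP.≤-pred (ℕP.<-≤-trans decreased measure))
    where
    nothingLearned : ∀ {z} → OnlyNeighbours z ⊥
    nothingLearned y y∈⊥ = ⊥-elim (∉⊥ y∈⊥)
    noneYet : suc k ≤ ∣ ⊥ {n} ∣ + suc k
    noneYet = ℕP.≤-reflexive (cong (_+ suc k) (sym (∣⊥∣≡0 n)))
    X′ : Subset n
    X′ = (X ∪ ⁅ x ⁆) ∪ ⁅ y ⁆
    X⊆X′ : X ⊆ X′
    X⊆X′ = p⊆p∪q ⁅ y ⁆ ∘ p⊆p∪q ⁅ x ⁆
    decreased : remaining X′ < remaining X
    decreased with K-cover x y e
    ... | inj₁ x∈K = remaining-decreases X⊆X′ x∈K (x∈∁p⇒x∉p x∈U) (p⊆p∪q ⁅ y ⁆ (x∈p∪q⁺ (inj₂ (x∈⁅x⁆ x))))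
    ... | inj₂ y∈K = remaining-decreases X⊆X′ y∈K (x∈∁p⇒x∉p y∈U) (x∈p∪q⁺ (inj₂ (x∈⁅x⁆ y)))

  -- ε: the probability that 2k random subsets all miss a given edge
  ε : ℚ
  ε = ½ ^ℚ (k + k)

  0≤ε : 0ℚ ≤ℚ ε
  0≤ε = ½^-nonNeg (k + k)

  -- With f rounds left and |K ∖ X| ≤ f, the output is a small cover with
  -- probability ≥ 1 - fε: a round with an edge outside X finds one except
  -- with probability ε (amplification), and without one the learned edges
  -- already determine a cover.
  round-correct : ∀ f X N → Invariant X N → remaining X ≤ f → Pr[ round f X N ]≥ 1-f*ε ε f
  round-correct zero X N inv measure =
    Pr≥-mono (coverLearned-correct inv (no-remaining⇒no-edge measure)) (1-f*ε≤1 0≤ε zero)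
  round-correct (suc f) X N inv measure with edgeOutside? X
  ... | yes (u , v , u∈ , v∈ , e) =
    Pr≥-≡ (1-f*ε-suc ε f)
      (Pr≥-amplify n (edge-irrefl e) (1-f*ε≤1 0≤ε f)
        (λ A c≤s t≥c → edgeTrial-preserves (∁ X) A (EdgesReach-mono reach c≤s) t≥c)
        (λ A t sep → edgeTrial-separating (∁ X) A reach u∈ v∈ e sep)
        (k + k))
    where
    reach : EdgesReach (∁ X) (processEdge f X N) (1-f*ε ε f)
    reach = processEdge-correct f X N inv measure (λ X′ N′ → round-correct f X′ N′)
  ... | no noEdge =
    Pr≥-repeat n (k + k)
      (Pr≥-mono (coverLearned-correct inv (λ u v u∈ v∈ e → noEdge (u , v , u∈ , v∈ , e))) (1-f*ε≤1 0≤ε (suc f)))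
      (λ A → edgeTrial-preserves (∁ X) A (λ x y x∈ y∈ e → ⊥-elim (noEdge (x , y , x∈ , y∈ , e))))

  alg-correct : Pr[ alg ]≥ 1-f*ε ε k
  alg-correct = round-correct k ⊥ (const ⊥) invariant-init remaining-init

-- k rounds of perRound = 4k + 2 ≤ 6k queries cost ≤ 6k² ≤ 6k²(1 + log k)
queries-bound : ∀ n k → 1 ≤ k → k * Algorithm.perRound n k ≤ 6 * (k ^ 2 * (1 + ⌊log₂ k ⌋))
queries-bound n (suc j) _ = begin
  k * ((k + k) + (suc k + suc k))  ≤⟨ ℕP.*-monoʳ-≤ k (ℕP.≤-trans (ℕP.m≤m+n _ (j + j)) (ℕP.≤-reflexive (sixfold j))) ⟩
  k * (6 * k)                      ≡⟨ square j ⟩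
  6 * k ^ 2                        ≤⟨ ℕP.*-monoʳ-≤ 6 (ℕP.m≤m*n (k ^ 2) (1 + ⌊log₂ k ⌋)) ⟩
  6 * (k ^ 2 * (1 + ⌊log₂ k ⌋))    ∎
  where
  k : ℕ
  k = suc j
  open ℕP.≤-Reasoning
  open ℕS.+-*-Solver
  sixfold : ∀ j → ((suc j + suc j) + (suc (suc j) + suc (suc j))) + (j + j) ≡ 6 * suc j
  sixfold = solve 1 (λ j → (((con 1 :+ j) :+ (con 1 :+ j)) :+ ((con 2 :+ j) :+ (con 2 :+ j))) :+ (j :+ j)
                           := con 6 :* (con 1 :+ j)) refl
  square : ∀ j → suc j * (6 * suc j) ≡ 6 * suc j ^ 2
  square = solve 1 (λ j → (con 1 :+ j) :* (con 6 :* (con 1 :+ j)) := con 6 :* ((con 1 :+ j) :^ 2)) refl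

theorem4 : Σ ((n k : ℕ) → Alg n) λ alg →
           ∃[ C ] ∃[ q ] (1 ≤ q) ×
             (∀ (n k : ℕ) → 1 ≤ k → (G : Graph n) → HasVertexCoverOfSize≤ G k →
              (O : Oracle n) → IsBISE G O →
                (queries O (alg n k) ≤ C * (k ^ 2 * (1 + ⌊log₂ k ⌋)))
              × (∃[ p ] GoodMass (λ S → IsVertexCover G S × ∣ S ∣ ≤ k) O (alg n k) p
                        × (((1ℚ -ℚ p) ^ℚ q) *ℚ toℚ k ≤ℚ 1ℚ)))
theorem4 = Algorithm.alg , 6 , 1 , ℕP.≤-refl , guarantee
  where
  guarantee : ∀ (n k : ℕ) → 1 ≤ k → (G : Graph n) → HasVertexCoverOfSize≤ G k →
              (O : Oracle n) → IsBISE G O →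
                (queries O (Algorithm.alg n k) ≤ 6 * (k ^ 2 * (1 + ⌊log₂ k ⌋)))
              × (∃[ p ] GoodMass (λ S → IsVertexCover G S × ∣ S ∣ ≤ k) O (Algorithm.alg n k) p
                        × (((1ℚ -ℚ p) ^ℚ 1) *ℚ toℚ k ≤ℚ 1ℚ))
  guarantee n k 1≤k G (K , K-cover , ∣K∣≤k) O bise =
      ℕP.≤-trans (Algorithm.Queries.queries-round n k O k ⊥ (const ⊥)) (queries-bound n k 1≤k)
    , (let p , mass , bound≤p = Analysis.alg-correct n k G O bise K K-cover ∣K∣≤k
       in  p , mass , failure*k≤1 k p bound≤p)
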